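{- Consider a random directed graph on $N$ vertices in which each of the $N(N-1)$ possible directed edges occurs independently with probability $6/N$. Then, except with probability that is exponentially small in $N$ (i.e. at most $e^{ -\Theta(N)}$), there is a vertex $v$ whose out-graph (set of vertices reachable from $v$ by directed paths) has size $\Theta(N)$ and whose in-graph (set of vertices from which $v$ is reachable) has size $\Theta(N)$.
   Context: $\Theta(N)$ denotes a quantity bounded above and below by positive universal constant multiples of $N$. -}

module Defs where

open import Data.Bool using (Bool; true; false; _∧_; _∨_; not; if_then_else_)
open import Data.Nat as ℕ using (ℕ; zero; suc; NonZero)
open import Data.Fin using (Fin; zero; suc; _≟_)
open import Data.List using (List; []; _∷_; map; concatMap; foldr; allFin)
open import Data.Bool.ListAction using (any)
open import Data.Integer using (+_)
open import Data.Rational using (ℚ; 0ℚ; 1ℚ; _+_; _*_; _-_; _/_)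
open import Relation.Nullary.Decidable using (⌊_⌋)

-- A directed graph on vertex set Fin N, given by its adjacency relation.
-- Only off-diagonal entries are edges (no loops).
Digraph : ℕ → Set
Digraph N = Fin N → Fin N → Bool

edge : ∀ {N} → Digraph N → Fin N → Fin N → Bool
edge G i j = not ⌊ i ≟ j ⌋ ∧ G i j

consF : ∀ {A : Set} {n} → A → (Fin n → A) → Fin (suc n) → A
consF x f zero    = x
consF x f (suc i) = f i

allFuns : ∀ {A : Set} → List A → (n : ℕ) → List (Fin n → A)
allFuns xs zero    = (λ ()) ∷ []
allFuns xs (suc n) = concatMap (λ x → map (consF x) (allFuns xs n)) xs

-- All 2^(N*N) adjacency matrices (those with a loop get probability 0 below).
allDigraphs : (N : ℕ) → List (Digraph N)
allDigraphs N = allFuns (allFuns (true ∷ false ∷ []) N) N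

prodℚ : ∀ {A : Set} → (A → ℚ) → List A → ℚ
prodℚ f = foldr (λ a r → f a * r) 1ℚ

sumℚ : ∀ {A : Set} → (A → ℚ) → List A → ℚ
sumℚ f = foldr (λ a r → f a + r) 0ℚ

weight : ∀ {N} → ℚ → Digraph N → ℚ
weight {N} p G = prodℚ (λ i → prodℚ (λ j → factor i j) (allFin N)) (allFin N)
  where
  factor : Fin N → Fin N → ℚ
  factor i j with ⌊ i ≟ j ⌋
  ... | true  = if G i j then 0ℚ else 1ℚ
  ... | false = if G i j then p else 1ℚ - p

Prob : (N : ℕ) → ℚ → (Digraph N → Bool) → ℚ
Prob N p E = sumℚ (λ G → if E G then weight p G else 0ℚ) (allDigraphs N)

reachIn : ∀ {N} → Digraph N → ℕ → Fin N → Fin N → Bool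
reachIn G zero    v j = ⌊ v ≟ j ⌋
reachIn {N} G (suc k) v j =
  reachIn G k v j ∨ any (λ i → reachIn G k v i ∧ edge G i j) (allFin N)

-- j reachable from v by a directed path (paths have length ≤ N).
reachable : ∀ {N} → Digraph N → Fin N → Fin N → Bool
reachable {N} G = reachIn G N

transpose : ∀ {N} → Digraph N → Digraph N
transpose G i j = G j i

outSize : ∀ {N} → Digraph N → Fin N → ℕ
outSize {N} G v = foldr (λ j r → (if reachable G v j then 1 else 0) ℕ.+ r) 0 (allFin N)

inSize : ∀ {N} → Digraph N → Fin N → ℕ
inSize G v = outSize (transpose G) v

powℚ : ℚ → ℕ → ℚ
powℚ q zero    = 1ℚ
powℚ q (suc n) = q * powℚ q n

edgeProb : (N : ℕ) → .{{NonZero N}} → ℚ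
edgeProb N = (+ 6) / N

-- The "bad" event: no vertex v has |out(v)| ≥ N/d and |in(v)| ≥ N/d
-- (written without division as N ≤ d·|out(v)|, N ≤ d·|in(v)|).
noGiantVertex : ∀ {N} → ℕ → Digraph N → Bool
noGiantVertex {N} d G =
  not (any (λ v → (N ℕ.≤ᵇ d ℕ.* outSize G v) ∧ (N ℕ.≤ᵇ d ℕ.* inSize G v)) (allFin N))

{-# OPTIONS --safe #-}
-- Call a vertex set closed if no edge leaves it. If no vertex has out- and in-graph both of
-- size at least N/3, some closed set has between N/3 and 2N/3 vertices. Greedily adding the
-- out-graphs of the vertices of a set X of at least N/3 vertices, each smaller than N/3, passes
-- through such a closed set; so some v has |out(v)| ≥ N/3. If |out(v)| > 2N/3 while
-- |in(v)| < N/3, the same applies to X = out(v) ∖ in(v), and a vertex u ∈ X with large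
-- out-graph has out(u) ⊊ out(v), as out(u) avoids in(v) ∋ v; so the descent terminates.
-- A fixed set of size s is closed with probability (1 - 6/N)^(s(N - s)); for mid-sized s this
-- is at most (7/10)^(2N) by Bernoulli's inequality on blocks of ⌊N/12⌋ factors, and summing
-- over the 2^N sets gives (49/50)^N.
module Submission where

open import Defs

module Arithmetic where

  open import Data.Nat using (zero; suc; _+_; _*_; _^_; _/_; _%_; _≤_; _<_; NonZero)
  open import Data.Nat.DivMod using (m/n*n≤m; m≡m%n+[m/n]*n; m%n<n; /-monoˡ-≤)
  open import Data.Nat.Properties
  open import Data.Nat.Tactic.RingSolver using (solve-∀)
  open import Data.Sum using (inj₁; inj₂)
  open import Relation.Binary.PropositionalEquality using (_≡_; sym; trans; cong; subst)

  sum-of-small-thirds : ∀ {N a b c} → 3 * a < N → 3 * b < N → c ≤ a + b → 3 * c ≤ 2 * N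
  sum-of-small-thirds {N} {a} {b} {c} a< b< c≤ = begin
    3 * c          ≤⟨ *-monoʳ-≤ 3 c≤ ⟩
    3 * (a + b)    ≡⟨ *-distribˡ-+ 3 a b ⟩
    3 * a + 3 * b  ≤⟨ +-mono-≤ (<⇒≤ a<) (<⇒≤ b<) ⟩
    N + N          ≡⟨ cong (N +_) (sym (+-identityʳ N)) ⟩
    2 * N          ∎
    where open ≤-Reasoning

  large-minus-small-third : ∀ {N a b c} → 2 * N < 3 * a → a ≤ b + c → 3 * c < N → N ≤ 3 * b
  large-minus-small-third {N} {a} {b} {c} a> a≤ c< = <⇒≤ (+-cancelʳ-< N N (3 * b) (begin-strict
    N + N          ≡⟨ cong (N +_) (sym (+-identityʳ N)) ⟩
    2 * N          <⟨ a> ⟩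
    3 * a          ≤⟨ *-monoʳ-≤ 3 a≤ ⟩
    3 * (b + c)    ≡⟨ *-distribˡ-+ 3 b c ⟩
    3 * b + 3 * c  <⟨ +-monoʳ-< (3 * b) c< ⟩
    3 * b + N      ∎))
    where open ≤-Reasoning

  -- Bernoulli's inequality (1 + a/m)^(k+1) ≥ 1 + (k+1)a/m, multiplied by m^(k+1).
  bernoulli : ∀ a m k → m ^ k * (m + a + a * k) ≤ (m + a) ^ suc k
  bernoulli a m zero    = ≤-reflexive (base a m)
    where
    base : ∀ a m → 1 * (m + a + a * 0) ≡ (m + a) * 1
    base = solve-∀
  bernoulli a m (suc k) = begin
    m ^ suc k * (m + a + a * suc k)           ≡⟨ rearrange m (m ^ k) (m + a + a * suc k) ⟩
    m ^ k * ((m + a + a * suc k) * m)         ≤⟨ *-monoʳ-≤ (m ^ k) one-step ⟩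
    m ^ k * ((m + a) * (m + a + a * k))       ≡⟨ swap (m ^ k) (m + a) _ ⟩
    (m + a) * (m ^ k * (m + a + a * k))       ≤⟨ *-monoʳ-≤ (m + a) (bernoulli a m k) ⟩
    (m + a) ^ suc (suc k)                     ∎
    where
    open ≤-Reasoning
    rearrange : ∀ x y z → x * y * z ≡ y * (z * x)
    rearrange = solve-∀
    swap : ∀ x y z → x * (y * z) ≡ y * (x * z)
    swap = solve-∀
    split : ∀ a m k → (m + a + a * suc k) * m ≡ m * (m + a + a * k) + a * m
    split = solve-∀
    m≤m+a+ak : m ≤ m + a + a * k
    m≤m+a+ak = ≤-trans (m≤m+n m a) (m≤m+n _ _)
    one-step : (m + a + a * suc k) * m ≤ (m + a) * (m + a + a * k)
    one-step = begin
      (m + a + a * suc k) * m                    ≡⟨ split a m k ⟩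
      m * (m + a + a * k) + a * m                ≤⟨ +-monoʳ-≤ _ (*-monoʳ-≤ a m≤m+a+ak) ⟩
      m * (m + a + a * k) + a * (m + a + a * k)  ≡⟨ *-distribʳ-+ _ m a ⟨
      (m + a) * (m + a + a * k)                  ∎

  -- ((N - 6)/N)^k ≤ 7/10 as soon as N ≤ 14k.
  bernoulli-block : ∀ {m N k} .{{_ : NonZero N}} → m + 6 ≡ N → N ≤ 14 * k →
                    m ^ k * 10 ≤ 7 * N ^ k
  bernoulli-block {m} {N} {k} m+6≡N N≤14k = *-cancelʳ-≤ _ _ N (begin
    m ^ k * 10 * N               ≡⟨ *-assoc (m ^ k) 10 N ⟩
    m ^ k * (10 * N)             ≤⟨ *-monoʳ-≤ (m ^ k) 10N≤ ⟩
    m ^ k * (7 * (N + 6 * k))    ≡⟨ swap (m ^ k) 7 _ ⟩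
    7 * (m ^ k * (N + 6 * k))    ≤⟨ *-monoʳ-≤ 7 bernoulli-N ⟩
    7 * (N * N ^ k)              ≡⟨ rotate (N ^ k) N ⟩
    7 * N ^ k * N                ∎)
    where
    open ≤-Reasoning
    swap : ∀ x y z → x * (y * z) ≡ y * (x * z)
    swap = solve-∀
    rotate : ∀ x y → 7 * (y * x) ≡ 7 * x * y
    rotate = solve-∀
    bernoulli-N : m ^ k * (N + 6 * k) ≤ N ^ suc k
    bernoulli-N = subst (λ n → m ^ k * (n + 6 * k) ≤ n ^ suc k) m+6≡N (bernoulli 6 m k)
    10N≤ : 10 * N ≤ 7 * (N + 6 * k)
    10N≤ = begin
      10 * N                    ≡⟨ *-distribʳ-+ N 7 3 ⟩
      7 * N + 3 * N             ≤⟨ +-monoʳ-≤ (7 * N) (*-monoʳ-≤ 3 N≤14k) ⟩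
      7 * N + 3 * (14 * k)      ≡⟨ cong (7 * N +_) (trans (sym (*-assoc 3 14 k)) (*-assoc 7 6 k)) ⟩
      7 * N + 7 * (6 * k)       ≡⟨ *-distribˡ-+ 7 N (6 * k) ⟨
      7 * (N + 6 * k)           ∎

  12*[N/12]≤N : ∀ N → 12 * (N / 12) ≤ N
  12*[N/12]≤N N = ≤-trans (≤-reflexive (*-comm 12 (N / 12))) (m/n*n≤m N 12)

  72≤N⇒N≤14*[N/12] : ∀ {N} → 72 ≤ N → N ≤ 14 * (N / 12)
  72≤N⇒N≤14*[N/12] {N} 72≤N = begin
    N                          ≡⟨ m≡m%n+[m/n]*n N 12 ⟩
    N % 12 + N / 12 * 12       ≤⟨ +-monoˡ-≤ _ (≤-trans (<⇒≤ (m%n<n N 12)) 12≤2k) ⟩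
    2 * (N / 12) + N / 12 * 12 ≡⟨ sum (N / 12) ⟩
    14 * (N / 12)              ∎
    where
    open ≤-Reasoning
    12≤2k : 12 ≤ 2 * (N / 12)
    12≤2k = *-monoʳ-≤ 2 (/-monoˡ-≤ 12 72≤N)
    sum : ∀ k → 2 * k + k * 12 ≡ 14 * k
    sum = solve-∀

  sorted-split-product : ∀ {N k s t} → 12 * k ≤ N → s ≤ t → s + t ≡ N → N ≤ 3 * s →
                         k * (2 * N) ≤ s * t
  sorted-split-product {N} {k} {s} {t} 12k≤N s≤t s+t≡N N≤3s = *-cancelˡ-≤ 6 (begin
    6 * (k * (2 * N))  ≡⟨ left k N ⟩
    12 * k * N         ≤⟨ *-monoˡ-≤ N 12k≤N ⟩
    N * N              ≤⟨ *-mono-≤ N≤3s N≤2t ⟩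
    3 * s * (2 * t)    ≡⟨ right s t ⟩
    6 * (s * t)        ∎)
    where
    open ≤-Reasoning
    left : ∀ k N → 6 * (k * (2 * N)) ≡ 12 * k * N
    left = solve-∀
    right : ∀ s t → 3 * s * (2 * t) ≡ 6 * (s * t)
    right = solve-∀
    N≤2t : N ≤ 2 * t
    N≤2t = begin
      N        ≡⟨ s+t≡N ⟨
      s + t    ≤⟨ +-monoˡ-≤ t s≤t ⟩
      t + t    ≡⟨ cong (t +_) (+-identityʳ t) ⟨
      2 * t    ∎

  balanced-split-product : ∀ {N k s t} → 12 * k ≤ N → s + t ≡ N → N ≤ 3 * s → N ≤ 3 * t →
                           k * (2 * N) ≤ s * t
  balanced-split-product {N} {k} {s} {t} 12k≤N s+t≡N N≤3s N≤3t with ≤-total s t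
  ... | inj₁ s≤t = sorted-split-product {k = k} 12k≤N s≤t s+t≡N N≤3s
  ... | inj₂ t≤s = subst (k * (2 * N) ≤_) (*-comm t s)
                     (sorted-split-product {k = k} 12k≤N t≤s (trans (+-comm t s) s+t≡N) N≤3t)

  complement-≥-third : ∀ {N s t} → s + t ≡ N → 3 * s ≤ 2 * N → N ≤ 3 * t
  complement-≥-third {N} {s} {t} s+t≡N 3s≤2N = +-cancelˡ-≤ (2 * N) N (3 * t) (begin
    2 * N + N          ≡⟨ thrice N ⟩
    3 * N              ≡⟨ cong (3 *_) s+t≡N ⟨
    3 * (s + t)        ≡⟨ *-distribˡ-+ 3 s t ⟩
    3 * s + 3 * t      ≤⟨ +-monoˡ-≤ (3 * t) 3s≤2N ⟩
    2 * N + 3 * t      ∎)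
    where
    open ≤-Reasoning
    thrice : ∀ N → 2 * N + N ≡ 3 * N
    thrice = solve-∀

module Digraphs where

  open import Data.Bool using (Bool; true; false; T; not; _∧_; _∨_; if_then_else_)
  open import Data.Bool.ListAction using (any)
  open import Data.Bool.Properties using (T-∧; T-∨)
  open import Data.Empty using (⊥-elim)
  open import Data.Fin using (Fin; _≟_)
  open import Data.Fin.Properties using (any?; toℕ<n)
  open import Data.List using (List; []; _∷_; foldr; length; allFin)
  open import Data.List.Membership.Propositional using (_∈_)
  open import Data.List.Membership.Propositional.Properties using (∈-allFin)
  open import Data.List.Properties using (length-tabulate)
  open import Data.List.Relation.Unary.Any as Any using (here; there)
  open import Data.List.Relation.Unary.Any.Properties using (any⁺; any⁻)
  open import Data.Nat using (ℕ; zero; suc; _+_; _*_; _≤_; _<_; z≤n; s≤s; _≤?_; _<?_)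
  open import Data.Nat.Properties hiding (_≟_)
  open import Data.Product using (∃; _×_; _,_)
  open import Data.Sum using (_⊎_; inj₁; inj₂)
  open import Function using (_∘_; Equivalence)
  open import Relation.Binary.PropositionalEquality using (_≡_; refl; sym; trans; cong; cong₂; subst)
  open import Relation.Nullary using (¬_; yes; no)
  open import Relation.Nullary.Decidable
    using (T?; ¬?; _×-dec_; decidable-stable; fromWitness; toWitness)
  open import Algebra.Properties.CommutativeSemigroup using (interchange)

  open Arithmetic using (sum-of-small-thirds; large-minus-small-third)
  open Equivalence using (to; from)

  indicator : Bool → ℕ
  indicator b = if b then 1 else 0

  -- The same fold as outSize in Defs, so ∣ reachable G v ∣ below is outSize G v by definition.
  count : ∀ {A : Set} → (A → Bool) → List A → ℕ
  count p = foldr (λ x r → indicator (p x) + r) 0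

  _⊆_ : ∀ {A : Set} → (A → Bool) → (A → Bool) → Set
  p ⊆ q = ∀ {x} → T (p x) → T (q x)

  indicator-mono : ∀ {a b} → (T a → T b) → indicator a ≤ indicator b
  indicator-mono {false}         _   = z≤n
  indicator-mono {true} {true}   _   = ≤-refl
  indicator-mono {true} {false} a⇒b = ⊥-elim (a⇒b _)

  indicator-mono-< : ∀ {a b} → ¬ T a → T b → indicator a < indicator b
  indicator-mono-< {false} {true} _ _ = ≤-refl
  indicator-mono-< {true}         ¬a _ = ⊥-elim (¬a _)

  not-T : ∀ {b} → T (not b) → ¬ T b
  not-T {false} _ ()

  T-∧-not-∨ : ∀ {a} b → T a → T ((a ∧ not b) ∨ b)
  T-∧-not-∨ {true} true  _ = _
  T-∧-not-∨ {true} false _ = _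

  indicator-∨ : ∀ a b → indicator (a ∨ b) ≤ indicator a + indicator b
  indicator-∨ true  _ = s≤s z≤n
  indicator-∨ false _ = ≤-refl

  ∈⇒any : ∀ {A : Set} (p : A → Bool) {x xs} → x ∈ xs → T (p x) → T (any p xs)
  ∈⇒any p x∈xs px = any⁺ p (Any.map (λ { refl → px }) x∈xs)

  module _ {A : Set} where

    count-false : ∀ (xs : List A) → count (λ _ → false) xs ≡ 0
    count-false []       = refl
    count-false (_ ∷ xs) = count-false xs

    count-true : ∀ (xs : List A) → count (λ _ → true) xs ≡ length xs
    count-true []       = refl
    count-true (_ ∷ xs) = cong suc (count-true xs)

    count-complement : ∀ (p : A → Bool) xs → count p xs + count (not ∘ p) xs ≡ length xs
    count-complement p [] = refl
    count-complement p (x ∷ xs) with p x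
    ... | true  = cong suc (count-complement p xs)
    ... | false = trans (+-suc _ _) (cong suc (count-complement p xs))

    count-cong : ∀ {p q : A → Bool} xs → (∀ x → p x ≡ q x) → count p xs ≡ count q xs
    count-cong []       _   = refl
    count-cong (x ∷ xs) p≗q = cong₂ _+_ (cong indicator (p≗q x)) (count-cong xs p≗q)

    count-mono : ∀ {p q : A → Bool} xs → p ⊆ q → count p xs ≤ count q xs
    count-mono []       _   = z≤n
    count-mono (x ∷ xs) p⊆q = +-mono-≤ (indicator-mono p⊆q) (count-mono xs p⊆q)

    count-mono-< : ∀ {p q : A → Bool} {x} xs → p ⊆ q → x ∈ xs → ¬ T (p x) → T (q x) →
                   count p xs < count q xs
    count-mono-< (_ ∷ xs) p⊆q (here refl) ¬px qx =
      +-mono-<-≤ (indicator-mono-< ¬px qx) (count-mono xs p⊆q)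
    count-mono-< (_ ∷ xs) p⊆q (there x∈xs) ¬px qx =
      +-mono-≤-< (indicator-mono p⊆q) (count-mono-< xs p⊆q x∈xs ¬px qx)

    count-pos : ∀ {p : A → Bool} {x} xs → x ∈ xs → T (p x) → 0 < count p xs
    count-pos xs x∈xs px = ≤-trans (s≤s z≤n) (count-mono-< {p = λ _ → false} xs (λ ()) x∈xs (λ ()) px)

    count-∨ : ∀ (p q : A → Bool) xs → count (λ x → p x ∨ q x) xs ≤ count p xs + count q xs
    count-∨ p q []       = z≤n
    count-∨ p q (x ∷ xs) = begin
      indicator (p x ∨ q x) + count (λ x → p x ∨ q x) xs
        ≤⟨ +-mono-≤ (indicator-∨ (p x) (q x)) (count-∨ p q xs) ⟩
      (indicator (p x) + indicator (q x)) + (count p xs + count q xs)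
        ≡⟨ interchange +-commutativeSemigroup (indicator (p x)) (indicator (q x)) _ _ ⟩
      count p (x ∷ xs) + count q (x ∷ xs) ∎
      where open ≤-Reasoning

  VertexSet : ℕ → Set
  VertexSet N = Fin N → Bool

  ∣_∣ : ∀ {N} → VertexSet N → ℕ
  ∣ S ∣ = count S (allFin _)

  ∣S∣≤N : ∀ {N} (S : VertexSet N) → ∣ S ∣ ≤ N
  ∣S∣≤N {N} S = begin
    ∣ S ∣                       ≤⟨ m≤m+n _ _ ⟩
    ∣ S ∣ + ∣ not ∘ S ∣         ≡⟨ count-complement S (allFin N) ⟩
    length (allFin N)           ≡⟨ length-tabulate _ ⟩
    N                           ∎
    where open ≤-Reasoning

  full : ∀ {N} → VertexSet N
  full _ = true

  ∣full∣≡N : ∀ {N} → ∣ full {N} ∣ ≡ N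
  ∣full∣≡N {N} = trans (count-true (allFin N)) (length-tabulate _)

  ⊆-or-witness : ∀ {N} (S₁ S₂ : VertexSet N) → S₁ ⊆ S₂ ⊎ ∃ λ j → T (S₁ j) × ¬ T (S₂ j)
  ⊆-or-witness S₁ S₂ with any? (λ j → T? (S₁ j) ×-dec ¬? (T? (S₂ j)))
  ... | yes witness = inj₂ witness
  ... | no none     = inj₁ λ {j} s₁j →
    decidable-stable (T? (S₂ j)) (λ ¬s₂j → none (j , s₁j , ¬s₂j))

  Closed : ∀ {N} → Digraph N → VertexSet N → Set
  Closed G S = ∀ {i j} → T (S i) → T (edge G i j) → T (S j)

  module _ {N} (G : Digraph N) where

    Stable : ℕ → Fin N → Set
    Stable k v = reachIn G (suc k) v ⊆ reachIn G k v

    reachIn-refl : ∀ k v → T (reachIn G k v v)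
    reachIn-refl zero    v = fromWitness refl
    reachIn-refl (suc k) v = from T-∨ (inj₁ (reachIn-refl k v))

    reachIn-step : ∀ k v {i j} → T (reachIn G k v i) → T (edge G i j) → T (reachIn G (suc k) v j)
    reachIn-step k v {i} vi ij = from T-∨ (inj₂ (∈⇒any _ (∈-allFin i) (from T-∧ (vi , ij))))

    reachIn-suc⁻ : ∀ k v {j} → T (reachIn G (suc k) v j) →
                   T (reachIn G k v j) ⊎ ∃ λ i → T (reachIn G k v i) × T (edge G i j)
    reachIn-suc⁻ k v vj with to T-∨ vj
    ... | inj₁ vj′ = inj₁ vj′
    ... | inj₂ step with Any.satisfied (any⁻ _ (allFin N) step)
    ...   | i , vi∧ij = inj₂ (i , to T-∧ vi∧ij)

    reachIn-least : ∀ {S} → Closed G S → ∀ k {v} → T (S v) → reachIn G k v ⊆ S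
    reachIn-least cl zero    sv vj = subst (T ∘ _) (toWitness vj) sv
    reachIn-least cl (suc k) sv vj with reachIn-suc⁻ k _ vj
    ... | inj₁ vj′            = reachIn-least cl k sv vj′
    ... | inj₂ (i , vi , ij) = cl (reachIn-least cl k sv vi) ij

    stable-suc : ∀ k v → Stable k v → Stable (suc k) v
    stable-suc k v st vj with reachIn-suc⁻ (suc k) v vj
    ... | inj₁ vj′            = vj′
    ... | inj₂ (i , vi , ij) = reachIn-step k v (st vi) ij

    stable-or-growing : ∀ k v → Stable k v ⊎ k < ∣ reachIn G k v ∣
    stable-or-growing zero    v = inj₂ (count-pos (allFin N) (∈-allFin v) (reachIn-refl zero v))
    stable-or-growing (suc k) v with stable-or-growing k v
    ... | inj₁ st = inj₁ (stable-suc k v st)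
    ... | inj₂ k<size with ⊆-or-witness (reachIn G (suc k) v) (reachIn G k v)
    ...   | inj₁ st                = inj₁ (stable-suc k v st)
    ...   | inj₂ (j , new , ¬old) = inj₂ (≤-trans (s≤s k<size)
      (count-mono-< (allFin N) (λ {j} → from T-∨ ∘ inj₁) (∈-allFin j) ¬old new))

    reachable-stable : ∀ v → Stable N v
    reachable-stable v with stable-or-growing N v
    ... | inj₁ st     = st
    ... | inj₂ N<size = ⊥-elim (<⇒≱ N<size (∣S∣≤N _))

    reachable-refl : ∀ v → T (reachable G v v)
    reachable-refl = reachIn-refl N

    reachable-closed : ∀ v → Closed G (reachable G v)
    reachable-closed v vi ij = reachable-stable v (reachIn-step N v vi ij)

    reachable-least : ∀ {S} → Closed G S → ∀ {v} → T (S v) → reachable G v ⊆ S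
    reachable-least cl = reachIn-least cl N

  edge⇒transpose : ∀ {N} (G : Digraph N) {i j} → T (edge G i j) → T (edge (transpose G) j i)
  edge⇒transpose G {i} {j} ij with i ≟ j | j ≟ i
  ... | no _    | no _    = ij
  ... | no i≢j  | yes j≡i = ⊥-elim (i≢j (sym j≡i))

  complement-closed : ∀ {N} (G : Digraph N) {S} → Closed (transpose G) S → Closed G (not ∘ S)
  complement-closed G {S} cl {i} {j} ¬si ij with S j in sj
  ... | false = _
  ... | true  = ¬si′ (cl (subst T (sym sj) _) (edge⇒transpose G ij))
    where
    ¬si′ : ¬ T (S i)
    ¬si′ si with S i
    ... | true = ¬si

  MidSized : ℕ → ℕ → Set
  MidSized N s = N ≤ 3 * s × 3 * s ≤ 2 * N

  module _ {N} (G : Digraph N) where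

    outGraph inGraph : Fin N → VertexSet N
    outGraph = reachable G
    inGraph  = reachable (transpose G)

    GiantVertex : Set
    GiantVertex = ∃ λ v → N ≤ 3 * ∣ outGraph v ∣ × N ≤ 3 * ∣ inGraph v ∣

    MidSizedClosedSet : Set
    MidSizedClosedSet = ∃ λ S → MidSized N ∣ S ∣ × Closed G S

    ⋃ : (Fin N → VertexSet N) → List (Fin N) → VertexSet N
    ⋃ S us j = any (λ u → S u j) us

    ⋃-closed : ∀ {S} → (∀ u → Closed G (S u)) → ∀ us → Closed G (⋃ S us)
    ⋃-closed cl us si ij = any⁺ _ (Any.map (λ {u} sui → cl u sui ij) (any⁻ _ us si))

    -- The prefix unions grow by less than N/3 at each step, so they cannot jump over [N/3, 2N/3].
    some-⋃-midSized : ∀ {S} → (∀ u → 3 * ∣ S u ∣ < N) →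
                      ∀ us → (∃ λ vs → MidSized N ∣ ⋃ S vs ∣) ⊎ 3 * ∣ ⋃ S us ∣ < N
    some-⋃-midSized {S} small [] with 3 * ∣ ⋃ S [] ∣ <? N
    ... | yes <N = inj₂ <N
    ... | no  ≮N = inj₁ ([] , ≮⇒≥ ≮N , subst (λ c → 3 * c ≤ 2 * N) (sym (count-false (allFin N))) z≤n)
    some-⋃-midSized {S} small (u ∷ us) with some-⋃-midSized small us
    ... | inj₁ found = inj₁ found
    ... | inj₂ <N with N ≤? 3 * ∣ ⋃ S (u ∷ us) ∣
    ...   | no  ≰ = inj₂ (≰⇒> ≰)
    ...   | yes ≤ = inj₁ (u ∷ us , ≤ , sum-of-small-thirds {a = ∣ S u ∣} (small u) <N
                                         (count-∨ (S u) (⋃ S us) (allFin N)))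

    outGraphIn : VertexSet N → Fin N → VertexSet N
    outGraphIn X u j = X u ∧ outGraph u j

    outGraphIn-closed : ∀ X u → Closed G (outGraphIn X u)
    outGraphIn-closed X u xu∧ui ij with to T-∧ xu∧ui
    ... | xu , ui = from T-∧ (xu , reachable-closed G u ui ij)

    outGraphIn-small : ∀ X → ¬ (∃ λ u → T (X u) × N ≤ 3 * ∣ outGraph u ∣) →
                       ∀ u → 3 * ∣ outGraphIn X u ∣ < N
    outGraphIn-small X none u with X u in xu
    ... | false = subst (λ c → 3 * c < N) (sym (count-false (allFin N))) (≤-trans (s≤s z≤n) (toℕ<n u))
    ... | true  = ≰⇒> λ N≤ → none (u , subst T (sym xu) _ , N≤)

    ⊆-⋃-outGraphIn : ∀ X → X ⊆ ⋃ (outGraphIn X) (allFin N)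
    ⊆-⋃-outGraphIn X {x} xx = ∈⇒any _ (∈-allFin x) (from T-∧ (xx , reachable-refl G x))

    greedy : ∀ X → N ≤ 3 * ∣ X ∣ → (∃ λ u → T (X u) × N ≤ 3 * ∣ outGraph u ∣) ⊎ MidSizedClosedSet
    greedy X N≤ with any? (λ u → T? (X u) ×-dec (N ≤? 3 * ∣ outGraph u ∣))
    ... | yes found = inj₁ found
    ... | no  none with some-⋃-midSized (outGraphIn-small X none) (allFin N)
    ...   | inj₁ (vs , mid) = inj₂ (⋃ (outGraphIn X) vs , mid , ⋃-closed (outGraphIn-closed X) vs)
    ...   | inj₂ <N =
      ⊥-elim (<⇒≱ <N (≤-trans N≤ (*-monoʳ-≤ 3 (count-mono (allFin N) (⊆-⋃-outGraphIn X)))))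

    outGraph∖inGraph : Fin N → VertexSet N
    outGraph∖inGraph v j = outGraph v j ∧ not (inGraph v j)

    outGraph∖inGraph-large : ∀ v → 2 * N < 3 * ∣ outGraph v ∣ → 3 * ∣ inGraph v ∣ < N →
                             N ≤ 3 * ∣ outGraph∖inGraph v ∣
    outGraph∖inGraph-large v out> in< = large-minus-small-third {c = ∣ inGraph v ∣} out>
      (≤-trans (count-mono (allFin N) (λ {j} → T-∧-not-∨ (inGraph v j)))
               (count-∨ (outGraph∖inGraph v) (inGraph v) (allFin N)))
      in<

    -- The complement of in(v) is closed, so out(u) avoids in(v) ∋ v, while out(u) ⊆ out(v).
    outGraph-shrinks : ∀ {u v} → T (outGraph∖inGraph v u) → ∣ outGraph u ∣ < ∣ outGraph v ∣
    outGraph-shrinks {u} {v} u∈ with to T-∧ u∈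
    ... | vu , ¬uv = count-mono-< (allFin N)
      (reachable-least G (reachable-closed G v) vu) (∈-allFin v)
      (λ uv → not-T (reachable-least G (complement-closed G (reachable-closed (transpose G) v)) ¬uv uv)
                    (reachable-refl (transpose G) v))
      (reachable-refl G v)

    descend : ∀ m v → ∣ outGraph v ∣ ≤ m → N ≤ 3 * ∣ outGraph v ∣ → GiantVertex ⊎ MidSizedClosedSet
    descend zero v ≤0 _ = ⊥-elim (<⇒≱ (count-pos (allFin N) (∈-allFin v) (reachable-refl G v)) ≤0)
    descend (suc m) v ≤m+1 N≤out with N ≤? 3 * ∣ inGraph v ∣ | 3 * ∣ outGraph v ∣ ≤? 2 * N
    ... | yes N≤in | _          = inj₁ (v , N≤out , N≤in)
    ... | no  _    | yes out≤   = inj₂ (outGraph v , (N≤out , out≤) , reachable-closed G v)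
    ... | no  N≰in | no  out≰
      with greedy (outGraph∖inGraph v) (outGraph∖inGraph-large v (≰⇒> out≰) (≰⇒> N≰in))
    ...   | inj₂ found = inj₂ found
    ...   | inj₁ (u , u∈ , N≤outu) = descend m u (≤-pred (≤-trans (outGraph-shrinks u∈) ≤m+1)) N≤outu

    giantVertex-or-midSizedClosedSet : GiantVertex ⊎ MidSizedClosedSet
    giantVertex-or-midSizedClosedSet with greedy full (≤-trans (≤-reflexive (sym ∣full∣≡N)) (m≤n*m _ 3))
    ... | inj₂ found          = inj₂ found
    ... | inj₁ (u , _ , N≤out) = descend N u (∣S∣≤N _) N≤out

  noGiantVertex⇒midSizedClosedSet : ∀ {N} (G : Digraph N) → T (noGiantVertex 3 G) → MidSizedClosedSet G
  noGiantVertex⇒midSizedClosedSet {N} G noGiant with giantVertex-or-midSizedClosedSet G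
  ... | inj₂ found = found
  ... | inj₁ (v , N≤out , N≤in) = ⊥-elim (not-T noGiant
    (∈⇒any _ (∈-allFin v) (from T-∧ (≤⇒≤ᵇ N≤out , ≤⇒≤ᵇ N≤in))))

module Sums where

  open import Algebra.Bundles using (CommutativeRing; CommutativeMonoid)
  open import Data.Bool using (Bool; true; false; if_then_else_)
  open import Data.Fin using (Fin; zero; suc)
  open import Data.List using (List; []; _∷_; _++_; foldr; map; concatMap; allFin; tabulate; length)
  open import Data.List.Membership.Propositional using (_∈_)
  open import Data.List.Relation.Unary.Any using (here; there)
  open import Data.Nat as ℕ using (ℕ; zero; suc)
  open import Data.Rational using (ℚ; 0ℚ; 1ℚ; _+_; _*_; _≤_; nonNegative)
  open import Data.Rational.Properties
  open import Function using (_∘_)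
  open import Relation.Binary.PropositionalEquality
    using (_≡_; refl; sym; trans; cong; cong₂; module ≡-Reasoning)

  open import Algebra.Properties.CommutativeSemiring.Exp
    (CommutativeRing.commutativeSemiring +-*-commutativeRing) public
    using (_^_; ^-assocʳ)
  open import Algebra.Properties.CommutativeSemigroup
    (CommutativeMonoid.commutativeSemigroup +-0-commutativeMonoid) using (interchange)

  open Digraphs using (count)

  *-mono-≤-nonneg : ∀ {a b c d} → 0ℚ ≤ a → 0ℚ ≤ c → a ≤ b → c ≤ d → a * c ≤ b * d
  *-mono-≤-nonneg {a} {b} {c} {d} 0≤a 0≤c a≤b c≤d = ≤-trans
    (*-monoʳ-≤-nonNeg c {{nonNegative 0≤c}} a≤b)
    (*-monoˡ-≤-nonNeg b {{nonNegative (≤-trans 0≤a a≤b)}} c≤d)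

  *-nonneg : ∀ {a b} → 0ℚ ≤ a → 0ℚ ≤ b → 0ℚ ≤ a * b
  *-nonneg 0≤a 0≤b = *-mono-≤-nonneg ≤-refl ≤-refl 0≤a 0≤b

  ^-nonneg : ∀ {x} n → 0ℚ ≤ x → 0ℚ ≤ x ^ n
  ^-nonneg zero    _   = ≤ᵇ⇒≤ _
  ^-nonneg (suc n) 0≤x = *-nonneg 0≤x (^-nonneg n 0≤x)

  ^-monoˡ-≤ : ∀ {x y} n → 0ℚ ≤ x → x ≤ y → x ^ n ≤ y ^ n
  ^-monoˡ-≤ zero    _   _   = ≤-refl
  ^-monoˡ-≤ (suc n) 0≤x x≤y = *-mono-≤-nonneg 0≤x (^-nonneg n 0≤x) x≤y (^-monoˡ-≤ n 0≤x x≤y)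

  ^-antitoneʳ-≤ : ∀ {x} {m n} → 0ℚ ≤ x → x ≤ 1ℚ → m ℕ.≤ n → x ^ n ≤ x ^ m
  ^-antitoneʳ-≤ {m = zero}  {zero}  _   _   _       = ≤-refl
  ^-antitoneʳ-≤ {x} {zero}  {suc n} 0≤x x≤1 _      = begin
    x * x ^ n   ≤⟨ *-mono-≤-nonneg 0≤x (^-nonneg n 0≤x) x≤1 (^-antitoneʳ-≤ {m = 0} {n} 0≤x x≤1 ℕ.z≤n) ⟩
    1ℚ * 1ℚ     ≡⟨⟩
    1ℚ          ∎
    where open ≤-Reasoning
  ^-antitoneʳ-≤ {x} {suc m} {suc n} 0≤x x≤1 (ℕ.s≤s m≤n) =
    *-monoˡ-≤-nonNeg x {{nonNegative 0≤x}} (^-antitoneʳ-≤ 0≤x x≤1 m≤n)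

  module _ {A : Set} where

    sumℚ-cong : ∀ {f g : A → ℚ} xs → (∀ x → f x ≡ g x) → sumℚ f xs ≡ sumℚ g xs
    sumℚ-cong []       _ = refl
    sumℚ-cong (x ∷ xs) f≗g = cong₂ _+_ (f≗g x) (sumℚ-cong xs f≗g)

    foldr-cong : ∀ {c : A → ℚ → ℚ} (g : A → ℚ) xs → (∀ a r → c a r ≡ g a * r) →
                 foldr c 1ℚ xs ≡ prodℚ g xs
    foldr-cong g []       _ = refl
    foldr-cong {c} g (x ∷ xs) h = trans (cong (c x) (foldr-cong g xs h)) (h x _)

    prodℚ-cong : ∀ {f g : A → ℚ} xs → (∀ x → f x ≡ g x) → prodℚ f xs ≡ prodℚ g xs
    prodℚ-cong []       _ = refl
    prodℚ-cong (x ∷ xs) f≗g = cong₂ _*_ (f≗g x) (prodℚ-cong xs f≗g)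

    sumℚ-mono : ∀ {f g : A → ℚ} xs → (∀ x → f x ≤ g x) → sumℚ f xs ≤ sumℚ g xs
    sumℚ-mono []       _ = ≤-refl
    sumℚ-mono (x ∷ xs) f≤g = +-mono-≤ (f≤g x) (sumℚ-mono xs f≤g)

    sumℚ-nonneg : ∀ {f : A → ℚ} xs → (∀ x → 0ℚ ≤ f x) → 0ℚ ≤ sumℚ f xs
    sumℚ-nonneg []       _   = ≤-refl
    sumℚ-nonneg (x ∷ xs) 0≤f = +-mono-≤ (0≤f x) (sumℚ-nonneg xs 0≤f)

    prodℚ-nonneg : ∀ {f : A → ℚ} xs → (∀ x → 0ℚ ≤ f x) → 0ℚ ≤ prodℚ f xs
    prodℚ-nonneg []       _   = ≤ᵇ⇒≤ _
    prodℚ-nonneg (x ∷ xs) 0≤f = *-nonneg (0≤f x) (prodℚ-nonneg xs 0≤f)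

    ≤-sumℚ : ∀ {f : A → ℚ} {x} xs → (∀ y → 0ℚ ≤ f y) → x ∈ xs → f x ≤ sumℚ f xs
    ≤-sumℚ {f} (y ∷ xs) 0≤f (here refl) = begin
      f y              ≡⟨ sym (+-identityʳ (f y)) ⟩
      f y + 0ℚ         ≤⟨ +-monoʳ-≤ (f y) (sumℚ-nonneg xs 0≤f) ⟩
      f y + sumℚ f xs  ∎
      where open ≤-Reasoning
    ≤-sumℚ {f} {x} (y ∷ xs) 0≤f (there x∈xs) = begin
      f x              ≡⟨ sym (+-identityˡ (f x)) ⟩
      0ℚ + f x         ≤⟨ +-mono-≤ (0≤f y) (≤-sumℚ xs 0≤f x∈xs) ⟩
      f y + sumℚ f xs  ∎
      where open ≤-Reasoning

    sumℚ-zero : ∀ xs → sumℚ (λ (_ : A) → 0ℚ) xs ≡ 0ℚ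
    sumℚ-zero []       = refl
    sumℚ-zero (_ ∷ xs) = trans (+-identityˡ _) (sumℚ-zero xs)

    sumℚ-+ : ∀ (f g : A → ℚ) xs → sumℚ (λ x → f x + g x) xs ≡ sumℚ f xs + sumℚ g xs
    sumℚ-+ f g []       = refl
    sumℚ-+ f g (x ∷ xs) = trans (cong (f x + g x +_) (sumℚ-+ f g xs))
                                (interchange (f x) (g x) (sumℚ f xs) (sumℚ g xs))

    sumℚ-++ : ∀ (f : A → ℚ) xs ys → sumℚ f (xs ++ ys) ≡ sumℚ f xs + sumℚ f ys
    sumℚ-++ f []       ys = sym (+-identityˡ _)
    sumℚ-++ f (x ∷ xs) ys = trans (cong (f x +_) (sumℚ-++ f xs ys)) (sym (+-assoc (f x) _ _))

    sumℚ-*ˡ : ∀ c (f : A → ℚ) xs → sumℚ (λ x → c * f x) xs ≡ c * sumℚ f xs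
    sumℚ-*ˡ c f []       = sym (*-zeroʳ c)
    sumℚ-*ˡ c f (x ∷ xs) = trans (cong (c * f x +_) (sumℚ-*ˡ c f xs)) (sym (*-distribˡ-+ c (f x) _))

    prodℚ-const : ∀ c (xs : List A) → prodℚ (λ _ → c) xs ≡ c ^ length xs
    prodℚ-const c []       = refl
    prodℚ-const c (_ ∷ xs) = cong (c *_) (prodℚ-const c xs)

    prodℚ-if : ∀ c (p : A → Bool) xs → prodℚ (λ x → if p x then c else 1ℚ) xs ≡ c ^ count p xs
    prodℚ-if c p []       = refl
    prodℚ-if c p (x ∷ xs) with p x
    ... | true  = cong (c *_) (prodℚ-if c p xs)
    ... | false = trans (*-identityˡ _) (prodℚ-if c p xs)

  module _ {A B : Set} where

    sumℚ-map : ∀ (f : B → ℚ) (g : A → B) xs → sumℚ f (map g xs) ≡ sumℚ (f ∘ g) xs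
    sumℚ-map f g []       = refl
    sumℚ-map f g (x ∷ xs) = cong (f (g x) +_) (sumℚ-map f g xs)

    sumℚ-concatMap : ∀ (f : B → ℚ) (g : A → List B) xs →
                     sumℚ f (concatMap g xs) ≡ sumℚ (λ x → sumℚ f (g x)) xs
    sumℚ-concatMap f g []       = refl
    sumℚ-concatMap f g (x ∷ xs) =
      trans (sumℚ-++ f (g x) (concatMap g xs)) (cong (sumℚ f (g x) +_) (sumℚ-concatMap f g xs))

    sumℚ-comm : ∀ (F : A → B → ℚ) xs ys →
                sumℚ (λ x → sumℚ (F x) ys) xs ≡ sumℚ (λ y → sumℚ (λ x → F x y) xs) ys
    sumℚ-comm F []       ys = sym (sumℚ-zero ys)
    sumℚ-comm F (x ∷ xs) ys =
      trans (cong (sumℚ (F x) ys +_) (sumℚ-comm F xs ys)) (sym (sumℚ-+ (F x) _ ys))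

  prodℚ-tabulate : ∀ {X : Set} {n} (g : X → ℚ) (f : Fin n → X) →
                   prodℚ g (tabulate f) ≡ prodℚ (g ∘ f) (allFin n)
  prodℚ-tabulate {n = zero}  g f = refl
  prodℚ-tabulate {n = suc n} g f = cong (g (f zero) *_)
    (trans (prodℚ-tabulate g (f ∘ suc)) (sym (prodℚ-tabulate (g ∘ f) suc)))

  sumℚ-allFuns-prodℚ : ∀ {A : Set} (xs : List A) n (φ : Fin n → A → ℚ) →
    sumℚ (λ f → prodℚ (λ i → φ i (f i)) (allFin n)) (allFuns xs n) ≡
    prodℚ (λ i → sumℚ (φ i) xs) (allFin n)
  sumℚ-allFuns-prodℚ xs zero    φ = +-identityʳ 1ℚ
  sumℚ-allFuns-prodℚ xs (suc n) φ = begin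
    sumℚ F (concatMap (λ x → map (consF x) fs) xs)
      ≡⟨ sumℚ-concatMap F (λ x → map (consF x) fs) xs ⟩
    sumℚ (λ x → sumℚ F (map (consF x) fs)) xs
      ≡⟨ sumℚ-cong xs row ⟩
    sumℚ (λ x → φ zero x * rest) xs
      ≡⟨ sumℚ-*ʳ ⟩
    sumℚ (φ zero) xs * rest
      ≡⟨ cong (sumℚ (φ zero) xs *_) (sym (prodℚ-tabulate (λ i → sumℚ (φ i) xs) suc)) ⟩
    prodℚ (λ i → sumℚ (φ i) xs) (allFin (suc n)) ∎
    where
    open ≡-Reasoning
    fs : List (Fin n → _)
    fs = allFuns xs n
    F : (Fin (suc n) → _) → ℚ
    F f = prodℚ (λ i → φ i (f i)) (allFin (suc n))
    rest : ℚ
    rest = prodℚ (λ i → sumℚ (φ (suc i)) xs) (allFin n)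
    sumℚ-*ʳ : sumℚ (λ x → φ zero x * rest) xs ≡ sumℚ (φ zero) xs * rest
    sumℚ-*ʳ = trans (sumℚ-cong xs (λ x → *-comm (φ zero x) rest))
                    (trans (sumℚ-*ˡ rest (φ zero) xs) (*-comm rest _))
    row : ∀ x → sumℚ F (map (consF x) fs) ≡ φ zero x * rest
    row x = begin
      sumℚ F (map (consF x) fs)
        ≡⟨ sumℚ-map F (consF x) fs ⟩
      sumℚ (λ f → φ zero x * prodℚ (λ i → φ i (consF x f i)) (tabulate suc)) fs
        ≡⟨ sumℚ-cong fs (λ f → cong (φ zero x *_) (prodℚ-tabulate (λ i → φ i (consF x f i)) suc)) ⟩
      sumℚ (λ f → φ zero x * prodℚ (λ i → φ (suc i) (f i)) (allFin n)) fs
        ≡⟨ sumℚ-*ˡ (φ zero x) _ fs ⟩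
      φ zero x * sumℚ (λ f → prodℚ (λ i → φ (suc i) (f i)) (allFin n)) fs
        ≡⟨ cong (φ zero x *_) (sumℚ-allFuns-prodℚ xs n (φ ∘ suc)) ⟩
      φ zero x * rest ∎

module Fractions where

  open import Data.Integer as ℤ using (+_)
  import Data.Integer.Properties as ℤ
  import Data.Integer.Tactic.RingSolver as ℤ-Solver
  open import Data.Nat as ℕ using (ℕ; zero; suc; NonZero)
  import Data.Nat.Properties as ℕ
  open import Data.Rational using (ℚ; 0ℚ; 1ℚ; _+_; _*_; _-_; -_; _/_; _≤_; toℚᵘ)
  open import Data.Rational.Properties
  import Data.Rational.Unnormalised as ℚᵘ
  import Data.Rational.Unnormalised.Properties as ℚᵘ
  open import Relation.Binary.PropositionalEquality
    using (_≡_; refl; sym; trans; cong; cong₂; subst; subst₂; module ≡-Reasoning)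

  open Arithmetic using (bernoulli-block; 12*[N/12]≤N; 72≤N⇒N≤14*[N/12]; balanced-split-product)
  open Sums using (_^_; ^-assocʳ; ^-nonneg; ^-monoˡ-≤; ^-antitoneʳ-≤)

  infixl 7 _//_

  _//_ : ℕ → (d : ℕ) → .{{NonZero d}} → ℚ
  m // d = + m / d

  toℚᵘ-// : ∀ m d → toℚᵘ (m // suc d) ℚᵘ.≃ ℚᵘ.mkℚᵘ (+ m) d
  toℚᵘ-// m d = toℚᵘ-fromℚᵘ (ℚᵘ.mkℚᵘ (+ m) d)

  //-mono-≤ : ∀ {a b} c d .{{_ : NonZero c}} .{{_ : NonZero d}} → a ℕ.* d ℕ.≤ b ℕ.* c → a // c ≤ b // d
  //-mono-≤ {a} {b} (suc c) (suc d) ad≤bc = toℚᵘ-cancel-≤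
    (ℚᵘ.≤-respˡ-≃ (ℚᵘ.≃-sym (toℚᵘ-// a c)) (ℚᵘ.≤-respʳ-≃ (ℚᵘ.≃-sym (toℚᵘ-// b d))
      (ℚᵘ.*≤* (subst₂ ℤ._≤_ (ℤ.pos-* a (suc d)) (ℤ.pos-* b (suc c)) (ℤ.+≤+ ad≤bc)))))

  //-* : ∀ a b c d .{{_ : NonZero c}} .{{_ : NonZero d}} →
        (a // c) * (b // d) ≡ _//_ (a ℕ.* b) (c ℕ.* d) {{ℕ.m*n≢0 c d}}
  //-* a b (suc c) (suc d) = toℚᵘ-injective (begin-equality
    toℚᵘ (a // suc c * (b // suc d))                  ≃⟨ toℚᵘ-homo-* (a // suc c) (b // suc d) ⟩
    toℚᵘ (a // suc c) ℚᵘ.* toℚᵘ (b // suc d)          ≃⟨ ℚᵘ.*-cong (toℚᵘ-// a c) (toℚᵘ-// b d) ⟩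
    ℚᵘ.mkℚᵘ (+ a ℤ.* + b) cd                          ≡⟨ cong (λ n → ℚᵘ.mkℚᵘ n cd) (sym (ℤ.pos-* a b)) ⟩
    ℚᵘ.mkℚᵘ (+ (a ℕ.* b)) cd                          ≃⟨ ℚᵘ.≃-sym (toℚᵘ-// (a ℕ.* b) cd) ⟩
    toℚᵘ ((a ℕ.* b) // (suc c ℕ.* suc d))             ∎)
    where
    open ℚᵘ.≤-Reasoning
    cd : ℕ
    cd = d ℕ.+ c ℕ.* suc d

  //-^ : ∀ a d .{{_ : NonZero d}} k → (a // d) ^ k ≡ _//_ (a ℕ.^ k) (d ℕ.^ k) {{ℕ.m^n≢0 d k}}
  //-^ a d zero    = refl
  //-^ a d {{d≢0}} (suc k) =
    trans (cong (a // d *_) (//-^ a d k)) (//-* a (a ℕ.^ k) d (d ℕ.^ k) {{d≢0}} {{ℕ.m^n≢0 d k}})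

  //-+ : ∀ a b d .{{_ : NonZero d}} → a // d + b // d ≡ (a ℕ.+ b) // d
  //-+ a b (suc d) = toℚᵘ-injective (begin-equality
    toℚᵘ (a // D + b // D)                      ≃⟨ toℚᵘ-homo-+ (a // D) (b // D) ⟩
    toℚᵘ (a // D) ℚᵘ.+ toℚᵘ (b // D)            ≃⟨ ℚᵘ.+-cong (toℚᵘ-// a d) (toℚᵘ-// b d) ⟩
    ℚᵘ.mkℚᵘ (+ a) d ℚᵘ.+ ℚᵘ.mkℚᵘ (+ b) d        ≃⟨ ℚᵘ.*≡* cross ⟩
    ℚᵘ.mkℚᵘ (+ (a ℕ.+ b)) d                      ≃⟨ ℚᵘ.≃-sym (toℚᵘ-// (a ℕ.+ b) d) ⟩
    toℚᵘ ((a ℕ.+ b) // D)                        ∎)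
    where
    open ℚᵘ.≤-Reasoning
    D : ℕ
    D = suc d
    distrib : ∀ x y z → (x ℤ.* z ℤ.+ y ℤ.* z) ℤ.* z ≡ (x ℤ.+ y) ℤ.* (z ℤ.* z)
    distrib = ℤ-Solver.solve-∀
    cross : (+ a ℤ.* + D ℤ.+ + b ℤ.* + D) ℤ.* + D ≡ + (a ℕ.+ b) ℤ.* + (D ℕ.* D)
    cross = trans (distrib (+ a) (+ b) (+ D))
                  (sym (cong₂ ℤ._*_ (ℤ.pos-+ a b) (ℤ.pos-* D D)))

  //-self : ∀ d .{{_ : NonZero d}} → d // d ≡ 1ℚ
  //-self (suc d) = toℚᵘ-injective (ℚᵘ.≃-trans (toℚᵘ-// (suc d) d)
    (ℚᵘ.*≡* (trans (ℤ.*-identityʳ (+ suc d)) (sym (ℤ.*-identityˡ (+ suc d))))))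

  1-//≡ : ∀ {m a d} .{{_ : NonZero d}} → m ℕ.+ a ≡ d → 1ℚ - a // d ≡ m // d
  1-//≡ {m} {a} {d} m+a≡d = begin
    1ℚ - a // d                  ≡⟨ cong (_- a // d) sum≡1 ⟨
    (m // d + a // d) - a // d   ≡⟨ +-assoc (m // d) (a // d) (- (a // d)) ⟩
    m // d + (a // d - a // d)   ≡⟨ cong (_+_ (m // d)) (+-inverseʳ (a // d)) ⟩
    m // d + 0ℚ                  ≡⟨ +-identityʳ (m // d) ⟩
    m // d                       ∎
    where
    open ≡-Reasoning
    sum≡1 : m // d + a // d ≡ 1ℚ
    sum≡1 = trans (//-+ m a d) (trans (cong (_// d) m+a≡d) (//-self d))

  1-6/N≡ : ∀ {N} .{{_ : NonZero N}} → 6 ℕ.≤ N → 1ℚ - 6 // N ≡ (N ℕ.∸ 6) // N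
  1-6/N≡ {N} 6≤N = 1-//≡ {N ℕ.∸ 6} {6} (ℕ.m∸n+n≡m 6≤N)

  0≤1-6/N : ∀ {N} .{{_ : NonZero N}} → 6 ℕ.≤ N → 0ℚ ≤ 1ℚ - 6 // N
  0≤1-6/N {N} 6≤N = subst (0ℚ ≤_) (sym (1-6/N≡ 6≤N)) (//-mono-≤ {0} {N ℕ.∸ 6} 1 N ℕ.z≤n)

  1-6/N≤1 : ∀ {N} .{{_ : NonZero N}} → 6 ℕ.≤ N → 1ℚ - 6 // N ≤ 1ℚ
  1-6/N≤1 {N} 6≤N = subst (_≤ 1ℚ) (sym (1-6/N≡ 6≤N)) (//-mono-≤ {N ℕ.∸ 6} {1} N 1
    (subst₂ ℕ._≤_ (sym (ℕ.*-identityʳ _)) (sym (ℕ.*-identityˡ N)) (ℕ.m∸n≤m N 6)))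

  block-power-≤ : ∀ {N k} .{{_ : NonZero N}} → 6 ℕ.≤ N → N ℕ.≤ 14 ℕ.* k →
                  (1ℚ - 6 // N) ^ k ≤ 7 // 10
  block-power-≤ {N} {k} 6≤N N≤14k = begin
    (1ℚ - 6 // N) ^ k                            ≡⟨ cong (_^ k) (1-6/N≡ 6≤N) ⟩
    (m // N) ^ k                                 ≡⟨ //-^ m N k ⟩
    _//_ (m ℕ.^ k) (N ℕ.^ k) {{ℕ.m^n≢0 N k}}
      ≤⟨ //-mono-≤ {m ℕ.^ k} {7} (N ℕ.^ k) 10 {{ℕ.m^n≢0 N k}} ratio ⟩
    7 // 10                                      ∎
    where
    open ≤-Reasoning
    m : ℕ
    m = N ℕ.∸ 6
    ratio : m ℕ.^ k ℕ.* 10 ℕ.≤ 7 ℕ.* N ℕ.^ k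
    ratio = bernoulli-block {k = k} (ℕ.m∸n+n≡m 6≤N) N≤14k

  -- Cut the exponent into 2N blocks of ⌊N/12⌋ factors, each block being at most 7/10.
  balanced-cut-≤ : ∀ {N} .{{_ : NonZero N}} → 72 ℕ.≤ N →
                   ∀ {s t} → s ℕ.+ t ≡ N → N ℕ.≤ 3 ℕ.* s → N ℕ.≤ 3 ℕ.* t →
                   (1ℚ - 6 // N) ^ (s ℕ.* t) ≤ (49 // 100) ^ N
  balanced-cut-≤ {N} 72≤N {s} {t} s+t≡N N≤3s N≤3t = begin
    r ^ (s ℕ.* t)          ≤⟨ ^-antitoneʳ-≤ 0≤r r≤1 2Nk≤st ⟩
    r ^ (k ℕ.* (2 ℕ.* N))  ≡⟨ ^-assocʳ r k (2 ℕ.* N) ⟨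
    (r ^ k) ^ (2 ℕ.* N)    ≤⟨ ^-monoˡ-≤ (2 ℕ.* N) (^-nonneg k 0≤r) block≤ ⟩
    (7 // 10) ^ (2 ℕ.* N)  ≡⟨ ^-assocʳ (7 // 10) 2 N ⟨
    (49 // 100) ^ N        ∎
    where
    open ≤-Reasoning
    k : ℕ
    k = N ℕ./ 12
    r : ℚ
    r = 1ℚ - 6 // N
    6≤N : 6 ℕ.≤ N
    6≤N = ℕ.≤-trans (ℕ.≤ᵇ⇒≤ 6 72 _) 72≤N
    0≤r : 0ℚ ≤ r
    0≤r = 0≤1-6/N 6≤N
    r≤1 : r ≤ 1ℚ
    r≤1 = 1-6/N≤1 6≤N
    2Nk≤st : k ℕ.* (2 ℕ.* N) ℕ.≤ s ℕ.* t
    2Nk≤st = balanced-split-product {N} {k} {s} {t} (12*[N/12]≤N N) s+t≡N N≤3s N≤3t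
    block≤ : r ^ k ≤ 7 // 10
    block≤ = block-power-≤ {N} {k} 6≤N (72≤N⇒N≤14*[N/12] 72≤N)

module RandomDigraph where

  open import Data.Bool using (Bool; true; false; T; not; _∧_; if_then_else_)
  open import Data.Bool.Properties using (T-∧; T-≡)
  open import Data.Empty using (⊥-elim)
  open import Data.Fin using (Fin; zero; suc; _≟_)
  open import Data.List using (List; []; _∷_; map; allFin)
  open import Data.List.Membership.Propositional using (_∈_)
  open import Data.List.Membership.Propositional.Properties using (∈-map⁺; ∈-concatMap⁺)
  open import Data.List.Properties using (length-tabulate)
  open import Data.List.Relation.Unary.Any as Any using (here; there)
  open import Data.Nat as ℕ using (ℕ; zero; suc; NonZero)
  import Data.Nat.Properties as ℕ
  open import Data.Product using (∃; _×_; _,_)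
  open import Data.Rational using (ℚ; 0ℚ; 1ℚ; _+_; _*_; _-_; _≤_)
  open import Data.Rational.Properties hiding (_≟_)
  open import Data.Rational.Solver using (module +-*-Solver)
  open import Function using (_∘_; id; Equivalence)
  open import Relation.Binary.PropositionalEquality
    using (_≡_; refl; sym; trans; cong; subst; module ≡-Reasoning)
  open import Relation.Nullary using (¬_)
  open import Relation.Nullary.Decidable using (⌊_⌋; fromWitnessFalse)

  open Arithmetic using (complement-≥-third)
  open Digraphs using (VertexSet; ∣_∣; Closed; count-false; count-cong; count-complement; not-T;
                       noGiantVertex⇒midSizedClosedSet)
  open Sums
  open Fractions using (_//_; //-mono-≤; 0≤1-6/N; balanced-cut-≤)
  open Equivalence using (to; from)

  bools : List Bool
  bools = true ∷ false ∷ []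

  allFuns-complete : ∀ {A : Set} {xs : List A} → (∀ x → x ∈ xs) →
                     ∀ n (f : Fin n → A) → ∃ λ g → g ∈ allFuns xs n × (∀ i → g i ≡ f i)
  allFuns-complete every zero    f = (λ ()) , here refl , λ ()
  allFuns-complete {xs = xs} every (suc n) f with allFuns-complete every n (f ∘ suc)
  ... | g , g∈ , g≗f = consF (f zero) g
                     , ∈-concatMap⁺ (λ x → map (consF x) (allFuns xs n))
                         (Any.map (λ { refl → ∈-map⁺ (consF (f zero)) g∈ }) (every (f zero)))
                     , λ { zero → refl ; (suc i) → g≗f i }

  ∈-bools : ∀ b → b ∈ bools
  ∈-bools true  = here refl
  ∈-bools false = there (here refl)

  entryWeight : (p : ℚ) (loop present : Bool) → ℚ
  entryWeight p true  present = if present then 0ℚ else 1ℚ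
  entryWeight p false present = if present then p else 1ℚ - p

  mutual
    weight-≡ : ∀ {N} p (G : Digraph N) →
      weight p G ≡ prodℚ (λ i → prodℚ (λ j → entryWeight p ⌊ i ≟ j ⌋ (G i j)) (allFin N)) (allFin N)
    weight-≡ {N} p G = foldr-cong row (allFin N) λ i r →
      cong (_* r) (foldr-cong (entry i) (allFin N) λ j s → factor-≡ p G i j s)
      where
      entry : Fin N → Fin N → ℚ
      entry i j = entryWeight p ⌊ i ≟ j ⌋ (G i j)
      row : Fin N → ℚ
      row i = prodℚ (entry i) (allFin N)

    -- The hole stands for factor p G i j * s, where factor is the local function of weight; it
    -- cannot be named outside Defs, so it is solved from the use in weight-≡ above.
    factor-≡ : ∀ {N} (p : ℚ) (G : Digraph N) (i j : Fin N) (s : ℚ) →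
               _ ≡ entryWeight p ⌊ i ≟ j ⌋ (G i j) * s
    factor-≡ p G i j s with ⌊ i ≟ j ⌋
    ... | true  = refl
    ... | false = refl

  leaves : ∀ {N} → VertexSet N → Fin N → Fin N → Bool
  leaves S i j = S i ∧ not (S j)

  leaves⇒≢ : ∀ {N} {S : VertexSet N} {i j} → T (leaves S i j) → ¬ i ≡ j
  leaves⇒≢ {S = S} {i} ij refl with S i
  ... | true = ij

  closedEntryWeight : (p : ℚ) (leaving loop present : Bool) → ℚ
  closedEntryWeight p leaving loop present = if leaving ∧ present then 0ℚ else entryWeight p loop present

  closedWeight : ∀ {N} → ℚ → VertexSet N → Digraph N → ℚ
  closedWeight {N} p S G =
    prodℚ (λ i → prodℚ (λ j → closedEntryWeight p (leaves S i j) ⌊ i ≟ j ⌋ (G i j))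
                        (allFin N))
          (allFin N)

  closedProb : ∀ {N} → ℚ → VertexSet N → ℚ
  closedProb p S = (1ℚ - p) ^ (∣ S ∣ ℕ.* ∣ not ∘ S ∣)

  closed-resp-≗ : ∀ {N} {G : Digraph N} {S S′ : VertexSet N} →
                  (∀ i → S′ i ≡ S i) → Closed G S → Closed G S′
  closed-resp-≗ {S = S} {S′} S′≗S cl s′i ij = subst T (sym (S′≗S _)) (cl (subst T (S′≗S _) s′i) ij)

  closedWeight-≡-weight : ∀ {N} p (G : Digraph N) {S} → Closed G S → closedWeight p S G ≡ weight p G
  closedWeight-≡-weight {N} p G {S} cl =
    trans (prodℚ-cong (allFin N) λ i → prodℚ-cong (allFin N) λ j → entry i j) (sym (weight-≡ p G))
    where
    entry : ∀ i j → closedEntryWeight p (leaves S i j) ⌊ i ≟ j ⌋ (G i j) ≡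
                    entryWeight p ⌊ i ≟ j ⌋ (G i j)
    entry i j with leaves S i j ∧ G i j in cut
    ... | false = refl
    ... | true with to T-∧ (subst T (sym cut) _)
    ...   | ij , gij with to T-∧ ij
    ...     | si , ¬sj =
      ⊥-elim (not-T ¬sj (cl si (from T-∧ (fromWitnessFalse (leaves⇒≢ {S = S} ij) , gij))))

  closedEntryWeight-sum : ∀ p leaving loop → (T leaving → T (not loop)) →
    sumℚ (closedEntryWeight p leaving loop) bools ≡ (if leaving then 1ℚ - p else 1ℚ)
  closedEntryWeight-sum p true  true  ¬loop = ⊥-elim (¬loop _)
  closedEntryWeight-sum p true  false _     = trans (+-identityˡ _) (+-identityʳ _)
  closedEntryWeight-sum p false true  _     = refl
  closedEntryWeight-sum p false false _     =
    solve 1 (λ p → p :+ ((con 1ℚ :- p) :+ con 0ℚ) := con 1ℚ) refl p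
    where open +-*-Solver

  closedWeight-sum : ∀ {N} p (S : VertexSet N) → sumℚ (closedWeight p S) (allDigraphs N) ≡ closedProb p S
  closedWeight-sum {N} p S = begin
    sumℚ (closedWeight p S) (allFuns (allFuns bools N) N)
      ≡⟨ sumℚ-allFuns-prodℚ (allFuns bools N) N (λ i row → prodℚ (λ j → entry i j (row j)) (allFin N)) ⟩
    prodℚ (λ i → sumℚ (λ row → prodℚ (λ j → entry i j (row j)) (allFin N)) (allFuns bools N)) (allFin N)
      ≡⟨ prodℚ-cong (allFin N) (λ i → sumℚ-allFuns-prodℚ bools N (entry i)) ⟩
    prodℚ (λ i → prodℚ (λ j → sumℚ (entry i j) bools) (allFin N)) (allFin N)
      ≡⟨ prodℚ-cong (allFin N) (λ i → prodℚ-cong (allFin N) λ j →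
           closedEntryWeight-sum p (leaves S i j) ⌊ i ≟ j ⌋ (fromWitnessFalse ∘ leaves⇒≢ {S = S})) ⟩
    prodℚ (λ i → prodℚ (λ j → if S i ∧ not (S j) then r else 1ℚ) (allFin N)) (allFin N)
      ≡⟨ prodℚ-cong (allFin N) row ⟩
    prodℚ (λ i → if S i then r ^ ∣ not ∘ S ∣ else 1ℚ) (allFin N)
      ≡⟨ prodℚ-if (r ^ ∣ not ∘ S ∣) S (allFin N) ⟩
    (r ^ ∣ not ∘ S ∣) ^ ∣ S ∣
      ≡⟨ ^-assocʳ r ∣ not ∘ S ∣ ∣ S ∣ ⟩
    r ^ (∣ not ∘ S ∣ ℕ.* ∣ S ∣)
      ≡⟨ cong (r ^_) (ℕ.*-comm ∣ not ∘ S ∣ ∣ S ∣) ⟩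
    r ^ (∣ S ∣ ℕ.* ∣ not ∘ S ∣) ∎
    where
    open ≡-Reasoning
    r : ℚ
    r = 1ℚ - p
    entry : Fin N → Fin N → Bool → ℚ
    entry i j = closedEntryWeight p (leaves S i j) ⌊ i ≟ j ⌋
    row : ∀ i → prodℚ (λ j → if S i ∧ not (S j) then r else 1ℚ) (allFin N) ≡
                (if S i then r ^ ∣ not ∘ S ∣ else 1ℚ)
    row i with S i
    ... | true  = prodℚ-if r (not ∘ S) (allFin N)
    ... | false = trans (prodℚ-if r (λ _ → false) (allFin N)) (cong (r ^_) (count-false (allFin N)))

  module _ (p : ℚ) (0≤p : 0ℚ ≤ p) (0≤1-p : 0ℚ ≤ 1ℚ - p) where

    entryWeight-nonneg : ∀ loop b → 0ℚ ≤ entryWeight p loop b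
    entryWeight-nonneg true  true  = ≤-refl
    entryWeight-nonneg true  false = ≤ᵇ⇒≤ _
    entryWeight-nonneg false true  = 0≤p
    entryWeight-nonneg false false = 0≤1-p

    closedWeight-nonneg : ∀ {N} (S : VertexSet N) G → 0ℚ ≤ closedWeight p S G
    closedWeight-nonneg {N} S G = prodℚ-nonneg (allFin N) λ i → prodℚ-nonneg (allFin N) λ j → entry i j
      where
      entry : ∀ i j → 0ℚ ≤ closedEntryWeight p (leaves S i j) ⌊ i ≟ j ⌋ (G i j)
      entry i j with leaves S i j ∧ G i j
      ... | true  = ≤-refl
      ... | false = entryWeight-nonneg ⌊ i ≟ j ⌋ (G i j)

    -- Union bound: each graph of the event is counted, with its weight, at one of its closed sets.
    prob-≤-closedSets : ∀ {N} (E : Digraph N → Bool) (P : ℕ → Bool) →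
      (∀ G → T (E G) → ∃ λ S → T (P ∣ S ∣) × Closed G S) →
      Prob N p E ≤ sumℚ (λ S → if P ∣ S ∣ then closedProb p S else 0ℚ) (allFuns bools N)
    prob-≤-closedSets {N} E P cover = begin
      Prob N p E
        ≤⟨ sumℚ-mono (allDigraphs N) inEvent≤ ⟩
      sumℚ (λ G → sumℚ (λ S → term S G) subsets) (allDigraphs N)
        ≡⟨ sumℚ-comm (λ G S → term S G) (allDigraphs N) subsets ⟩
      sumℚ (λ S → sumℚ (term S) (allDigraphs N)) subsets
        ≡⟨ sumℚ-cong subsets perSet ⟩
      sumℚ (λ S → if P ∣ S ∣ then closedProb p S else 0ℚ) subsets ∎
      where
      open ≤-Reasoning
      subsets : List (VertexSet N)
      subsets = allFuns bools N
      term : VertexSet N → Digraph N → ℚ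
      term S G = if P ∣ S ∣ then closedWeight p S G else 0ℚ

      term-nonneg : ∀ G S → 0ℚ ≤ term S G
      term-nonneg G S with P ∣ S ∣
      ... | true  = closedWeight-nonneg S G
      ... | false = ≤-refl

      inEvent≤ : ∀ G → (if E G then weight p G else 0ℚ) ≤ sumℚ (λ S → term S G) subsets
      inEvent≤ G with E G in inE
      ... | false = sumℚ-nonneg subsets (term-nonneg G)
      ... | true with cover G (subst T (sym inE) _)
      ...   | S , PS , closed with allFuns-complete ∈-bools N S
      ...     | S′ , S′∈ , S′≗S = ≤-trans (≤-reflexive weight≡term) (≤-sumℚ subsets (term-nonneg G) S′∈)
        where
        weight≡term : weight p G ≡ term S′ G
        weight≡term rewrite count-cong (allFin N) S′≗S | to T-≡ PS =
          sym (closedWeight-≡-weight p G (closed-resp-≗ S′≗S closed))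

      perSet : ∀ S → sumℚ (term S) (allDigraphs N) ≡ (if P ∣ S ∣ then closedProb p S else 0ℚ)
      perSet S with P ∣ S ∣
      ... | true  = closedWeight-sum p S
      ... | false = sumℚ-zero (allDigraphs N)

  midSizedᵇ : ℕ → ℕ → Bool
  midSizedᵇ N s = (N ℕ.≤ᵇ 3 ℕ.* s) ∧ (3 ℕ.* s ℕ.≤ᵇ 2 ℕ.* N)

  prob-noGiantVertex-≤ : ∀ N .{{_ : NonZero N}} → 72 ℕ.≤ N →
                         Prob N (edgeProb N) (noGiantVertex 3) ≤ (49 // 50) ^ N
  prob-noGiantVertex-≤ N 72≤N = begin
    Prob N p (noGiantVertex 3)
      ≤⟨ prob-≤-closedSets p 0≤p 0≤1-p {N} (noGiantVertex 3) (midSizedᵇ N) cover ⟩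
    sumℚ (λ S → if midSizedᵇ N ∣ S ∣ then closedProb p S else 0ℚ) (allFuns bools N)
      ≤⟨ sumℚ-mono (allFuns bools N) perSet ⟩
    sumℚ (λ _ → prodℚ (λ _ → 49 // 100) (allFin N)) (allFuns bools N)
      ≡⟨ sumℚ-allFuns-prodℚ bools N (λ _ _ → 49 // 100) ⟩
    prodℚ (λ _ → 49 // 50) (allFin N)
      ≡⟨ prodℚ-const≡^ (49 // 50) ⟩
    (49 // 50) ^ N ∎
    where
    open ≤-Reasoning
    p : ℚ
    p = edgeProb N
    6≤N : 6 ℕ.≤ N
    6≤N = ℕ.≤-trans (ℕ.≤ᵇ⇒≤ 6 72 _) 72≤N
    0≤p : 0ℚ ≤ p
    0≤p = //-mono-≤ {0} {6} 1 N ℕ.z≤n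
    0≤1-p : 0ℚ ≤ 1ℚ - p
    0≤1-p = 0≤1-6/N 6≤N
    prodℚ-const≡^ : ∀ c → prodℚ (λ _ → c) (allFin N) ≡ c ^ N
    prodℚ-const≡^ c = trans (prodℚ-const c (allFin N)) (cong (c ^_) (length-tabulate {n = N} id))
    cover : ∀ G → T (noGiantVertex 3 G) → ∃ λ S → T (midSizedᵇ N ∣ S ∣) × Closed G S
    cover G noGiant with noGiantVertex⇒midSizedClosedSet G noGiant
    ... | S , (N≤3s , 3s≤2N) , closed = S , from T-∧ (ℕ.≤⇒≤ᵇ N≤3s , ℕ.≤⇒≤ᵇ 3s≤2N) , closed
    perSet : ∀ S → (if midSizedᵇ N ∣ S ∣ then closedProb p S else 0ℚ) ≤
                   prodℚ (λ _ → 49 // 100) (allFin N)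
    perSet S with midSizedᵇ N ∣ S ∣ in mid
    ... | false = prodℚ-nonneg {f = λ _ → 49 // 100} (allFin N) (λ _ → ≤ᵇ⇒≤ _)
    ... | true with to T-∧ (subst T (sym mid) _)
    ...   | N≤3s , 3s≤2N = subst (closedProb p S ≤_) (sym (prodℚ-const≡^ (49 // 100)))
      (balanced-cut-≤ 72≤N {∣ S ∣} {∣ not ∘ S ∣} s+t≡N (ℕ.≤ᵇ⇒≤ _ _ N≤3s) N≤3t)
      where
      s+t≡N : ∣ S ∣ ℕ.+ ∣ not ∘ S ∣ ≡ N
      s+t≡N = trans (count-complement S (allFin N)) (length-tabulate {n = N} id)
      N≤3t : N ℕ.≤ 3 ℕ.* ∣ not ∘ S ∣
      N≤3t = complement-≥-third {N} {∣ S ∣} s+t≡N (ℕ.≤ᵇ⇒≤ _ _ 3s≤2N)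

open import Data.Nat using (ℕ; zero; suc; NonZero; _≤_)
open import Data.Product using (Σ; _×_; _,_)
open import Data.Rational using (ℚ; 0ℚ; 1ℚ; _*_) renaming (_≤_ to _≤ℚ_; _<_ to _<ℚ_)
open import Data.Rational.Properties using (≤ᵇ⇒≤; _<?_)
open import Relation.Binary.PropositionalEquality using (_≡_; refl; sym; cong; subst)
open import Relation.Nullary.Decidable using (toWitness)

open Fractions using (_//_)
open RandomDigraph using (prob-noGiantVertex-≤)
open Sums using (_^_)

powℚ≡^ : ∀ q n → powℚ q n ≡ q ^ n
powℚ≡^ q zero    = refl
powℚ≡^ q (suc n) = cong (q *_) (powℚ≡^ q n)

lemma8p1 : Σ ℕ λ d → NonZero d × Σ ℚ λ q → (0ℚ ≤ℚ q) × (q <ℚ 1ℚ) × Σ ℕ λ N₀ →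
             (N : ℕ) → .{{_ : NonZero N}} → N₀ ≤ N →
             Prob N (edgeProb N) (noGiantVertex d) ≤ℚ powℚ q N
lemma8p1 = 3 , _ , 49 // 50 , ≤ᵇ⇒≤ _ , toWitness {a? = 49 // 50 <? 1ℚ} _ , 72 , λ N 72≤N →
  subst (Prob N (edgeProb N) (noGiantVertex 3) ≤ℚ_) (sym (powℚ≡^ (49 // 50) N))
        (prob-noGiantVertex-≤ N 72≤N)
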